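{- Let $\mathfrak{F}$ be a Kripke frame and $\varphi$ a closed disjunctive $\mathsf{A}$-clause. If $\mathfrak{F}\Vdash\varphi$, then $\mathfrak{G}\Vdash\varphi$ for every generated subframe $\mathfrak{G}$ of $\mathfrak{F}$.
   Context: $\mathrm{ML}$-formulas: $\varphi ::= p \mid \neg p \mid (\varphi\wedge\varphi)\mid(\varphi\vee\varphi)\mid\Diamond\varphi\mid\Box\varphi$. A closed disjunctive $\mathsf{A}$-clause is a formula $\mathsf{A}\psi_1\vee\dots\vee\mathsf{A}\psi_n$ with $\psi_i\in\mathrm{ML}$, where $\mathfrak{M},w\Vdash\mathsf{A}\psi$ iff $\psi$ is true at every point of $\mathfrak{M}$ (standard Kripke semantics). $\mathfrak{F}\Vdash\varphi$ means $\varphi$ is true at every point of $(\mathfrak{F},V)$ for every valuation $V$. A generated subframe of $(W,R)$ is $(W',R\cap W'^2)$ with $W'\subseteq W$ closed under $R$-successors. -}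

module Defs where

open import Data.Nat using (ℕ)
open import Data.Product using (Σ; _×_; _,_; proj₁)
open import Data.Sum using (_⊎_)
open import Data.List.NonEmpty using (List⁺; toList)
open import Data.List.Relation.Unary.Any using (Any)
open import Relation.Nullary using (¬_)
import Relation.Nullary as N

Var : Set
Var = ℕ

-- ML-formulas in negation normal form.
data ML : Set where
  var  : Var → ML
  nvar : Var → ML
  _∧_  : ML → ML → ML
  _∨_  : ML → ML → ML
  ◇_   : ML → ML
  □_   : ML → ML

record Frame : Set₁ where
  field
    W : Set
    R : W → W → Set
open Frame public

Valuation : Frame → Set₁
Valuation F = Var → W F → Set

_,_⊩_at_ : (F : Frame) → Valuation F → ML → W F → Set
F , V ⊩ var p at w  = V p w
F , V ⊩ nvar p at w = ¬ V p w
F , V ⊩ (φ ∧ ψ) at w = (F , V ⊩ φ at w) × (F , V ⊩ ψ at w)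
F , V ⊩ (φ ∨ ψ) at w = (F , V ⊩ φ at w) ⊎ (F , V ⊩ ψ at w)
F , V ⊩ (◇ φ) at w = Σ (W F) λ v → R F w v × (F , V ⊩ φ at v)
F , V ⊩ (□ φ) at w = ∀ v → R F w v → F , V ⊩ φ at v

-- Closed disjunctive A-clause  A ψ₁ ∨ … ∨ A ψₙ  (n ≥ 1), given by its list ψ₁,…,ψₙ.
AClause : Set
AClause = List⁺ ML

_,_⊩A_at_ : (F : Frame) → Valuation F → AClause → W F → Set
F , V ⊩A χ at w = Any (λ ψ → ∀ v → F , V ⊩ ψ at v) (toList χ)

_⊩A_ : Frame → AClause → Set₁
F ⊩A χ = (V : Valuation F) → (w : W F) → F , V ⊩A χ at w

-- A generated subframe is given by a subset W' ⊆ W (a proof-irrelevant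
-- predicate) closed under R-successors.
record GenSub (F : Frame) : Set₁ where
  field
    In         : W F → Set
    irrelevant : ∀ {w} → N.Irrelevant (In w)
    closed     : ∀ {w v} → In w → R F w v → In v

subframe : (F : Frame) → GenSub F → Frame
subframe F G = record
  { W = Σ (W F) (GenSub.In G)
  ; R = λ x y → R F (proj₁ x) (proj₁ y) }

-- Extend a valuation of the generated subframe to the whole frame by making every
-- variable false outside it. Since the subframe is closed under successors, every
-- formula true at a point of the subframe in the big model is true there in the
-- submodel; so if some ψᵢ holds everywhere in the big model (validity of the clause
-- in F), it holds everywhere in the submodel.
module Submission where

open import Defs
open import Data.Product using (Σ; _,_)
open import Data.Sum using (inj₁; inj₂)
import Data.List.Relation.Unary.Any as Any
open import Relation.Binary.PropositionalEquality using (subst)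

module _ (F : Frame) (G : GenSub F) where
  open GenSub G

  extendValuation : Valuation (subframe F G) → Valuation F
  extendValuation V p w = Σ (In w) λ h → V p (w , h)

  ⊩-restrict : ∀ V ψ w (h : In w) →
               F , extendValuation V ⊩ ψ at w → subframe F G , V ⊩ ψ at (w , h)
  ⊩-restrict V (var p)  w h (h′ , x) = subst (λ k → V p (w , k)) (irrelevant h′ h) x
  ⊩-restrict V (nvar p) w h ¬x x     = ¬x (h , x)
  ⊩-restrict V (φ ∧ ψ)  w h (a , b)  = ⊩-restrict V φ w h a , ⊩-restrict V ψ w h b
  ⊩-restrict V (φ ∨ ψ)  w h (inj₁ a) = inj₁ (⊩-restrict V φ w h a)
  ⊩-restrict V (φ ∨ ψ)  w h (inj₂ b) = inj₂ (⊩-restrict V ψ w h b)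
  ⊩-restrict V (◇ φ)    w h (v , r , a) =
    (v , closed h r) , r , ⊩-restrict V φ v (closed h r) a
  ⊩-restrict V (□ φ)    w h a (v , hv) r = ⊩-restrict V φ v hv (a v r)

propositionA3 : (F : Frame) (φ : AClause) → F ⊩A φ → (G : GenSub F) → subframe F G ⊩A φ
propositionA3 F φ valid G V (w , _) =
  Any.map (λ {ψ} everywhere (v , h) → ⊩-restrict F G V ψ v h (everywhere v))
          (valid (extendValuation F G V) w)
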